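{- Let $n\geq 3$ be an integer and let $(x_1,\ldots,x_n)$ be positive integers with $x_1\leq\cdots\leq x_n$ satisfying $\sigma_2(x_1,\ldots,x_n)=\sigma_n(x_1,\ldots,x_n)$. Then $$x_{n-2}\leq 1+\lfloor 2(n-2)^{2/3}\rfloor,$$ where equality holds only if $n=3$. Moreover, for each real $C>2^{ -1/3}$ there are only finitely many integers $n\geq 3$ for which there exists such an $n$-tuple $(x_1,\ldots,x_n)$ with $x_{n-2}>\lceil C(n-2)^{2/3}\rceil$.
   Context: $\sigma_k$ denotes the $k$-th elementary symmetric polynomial in $n$ variables.
   Formalization: The constant C in the finiteness clause ranges over the rationals greater than $2^{ -1/3}$ rather than over all reals. -}

module Defs where

open import Data.Nat using (ℕ; zero; suc; s≤s; _+_; _*_; _∸_; _^_; _≤_; _<_)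
open import Data.Nat.Properties using ()
open import Data.Fin as Fin using (Fin; fromℕ; inject₁)
open import Data.Product using (_×_)
open import Relation.Binary.PropositionalEquality using (_≡_)

σ : (k : ℕ) {n : ℕ} → (Fin n → ℕ) → ℕ
σ zero    x = 1
σ (suc k) {zero}  x = 0
σ (suc k) {suc n} x = x Fin.zero * σ k (λ i → x (Fin.suc i)) + σ (suc k) (λ i → x (Fin.suc i))

-- The (0-based) index of x_{n-2}, i.e. the Fin n element with value n - 3 (needs n ≥ 3).
idx : (n : ℕ) → 3 ≤ n → Fin n
idx (suc (suc (suc m))) _ = inject₁ (inject₁ (fromℕ m))
idx (suc zero) (s≤s ())
idx (suc (suc zero)) (s≤s (s≤s ()))

Admissible : (n : ℕ) → (Fin n → ℕ) → Set
Admissible n x =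
  (∀ i → 1 ≤ x i) × (∀ i j → i Fin.≤ j → x i ≤ x j) × (σ 2 x ≡ σ n x)

-- f = ⌊2 (n-2)^{2/3}⌋ = ⌊(8 (n-2)²)^{1/3}⌋  ⇔  f³ ≤ 8(n-2)² < (f+1)³.
IsFloorTwoPow : ℕ → ℕ → Set
IsFloorTwoPow n f = (f ^ 3 ≤ 8 * (n ∸ 2) ^ 2) × (8 * (n ∸ 2) ^ 2 < suc f ^ 3)

-- For C = a/b (b ≥ 1), c = ⌈C (n-2)^{2/3}⌉, i.e. c is the least natural with
-- a³(n-2)² ≤ (b c)³.  Written as: c = 0 and a³(n-2)² ≤ 0, or c = c'+1 with
-- (b c')³ < a³(n-2)² ≤ (b (c'+1))³.
data IsCeilRatPow (a b n : ℕ) : ℕ → Set where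
  ceil-zero : a ^ 3 * (n ∸ 2) ^ 2 ≤ 0 → IsCeilRatPow a b n 0
  ceil-suc  : (c : ℕ) → (b * c) ^ 3 < a ^ 3 * (n ∸ 2) ^ 2
            → a ^ 3 * (n ∸ 2) ^ 2 ≤ (b * suc c) ^ 3 → IsCeilRatPow a b n (suc c)

-- Write n = m + 3, let v = (x₁, …, x_m) and let t ≤ y ≤ z be the last three entries, so that
-- t = x_{n-2} bounds every entry of v.  With S, Q, P the sum, σ₂ and product of v, the equation
-- σ₂ = σₙ reads Q + S(t + y + z) + (ty + tz + yz) = P·tyz, and y, z ≥ t give t³P ≤ Q + 3St + 3t².
-- As the entries of v lie in [1, t], also m ≤ S ≤ mt, S − m < P and 2Q + S ≤ S², which turn this
-- into the cubic inequality 2t³ ≤ 6t² + 6tm + m².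
-- If t > ⌊2(m+1)^{2/3}⌋ then t³ > 8(m+1)², and the cubic inequality forces t ≤ 5, hence m = 0 and
-- t = 3.  If t > ⌈(a/b)(m+1)^{2/3}⌉ with 2a³ > b³, then 2b³t³ > (b³+1)(m+1)², which against the
-- cubic inequality bounds m by a polynomial in b.
module Submission where

open import Defs
open import Data.Nat using (ℕ; zero; suc; z≤n; s≤s; z<s; _+_; _*_; _^_; _∸_; _≤_; _<_; _≤?_; _<?_; _≟_; NonZero; >-nonZero)
open import Data.Nat.Properties
open import Data.Nat.Tactic.RingSolver using (solve-∀)
open import Data.Fin as Fin using (Fin; toℕ; fromℕ<)
open import Data.Fin.Properties using (all?; toℕ-fromℕ<)
open import Data.Vec.Functional using (Vector; []; _∷_; head; tail)
open import Data.Product using (_×_; _,_; proj₁; proj₂; Σ; ∃-syntax)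
open import Data.Sum using (inj₁; inj₂)
open import Function using (_∘_)
open import Relation.Binary.PropositionalEquality using (_≡_; refl; sym; trans; cong; cong₂; subst; subst₂; module ≡-Reasoning)
open import Relation.Nullary using (¬_; Dec; yes; no)
open import Relation.Nullary.Decidable using (toWitness; _×-dec_; _→-dec_)

σ-vanish : ∀ {n} k (x : Vector ℕ n) → n < k → σ k x ≡ 0
σ-vanish {zero}  (suc k) x _ = refl
σ-vanish {suc n} (suc k) x (s≤s n<k) = begin
  head x * σ k (tail x) + σ (suc k) (tail x) ≡⟨ cong₂ (λ a b → head x * a + b) (σ-vanish k (tail x) n<k) (σ-vanish (suc k) (tail x) (m<n⇒m<1+n n<k)) ⟩
  head x * 0 + 0                             ≡⟨ cong (_+ 0) (*-zeroʳ (head x)) ⟩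
  0                                          ∎
  where open ≡-Reasoning

σ₁-cons : ∀ {n} (x : Vector ℕ (suc n)) → σ 1 x ≡ head x + σ 1 (tail x)
σ₁-cons x = cong (_+ σ 1 (tail x)) (*-identityʳ (head x))

σₙ-cons : ∀ {n} (x : Vector ℕ (suc n)) → σ (suc n) x ≡ head x * σ n (tail x)
σₙ-cons {n} x = trans (cong (head x * σ n (tail x) +_) (σ-vanish (suc n) (tail x) ≤-refl)) (+-identityʳ _)

prefix : ∀ m → Vector ℕ (3 + m) → Vector ℕ m
prefix zero    x = []
prefix (suc m) x = head x ∷ prefix m (tail x)

suffix : ∀ m → Vector ℕ (3 + m) → Vector ℕ 3
suffix zero    x = x
suffix (suc m) x = suffix m (tail x)

σ₁-split : ∀ m (x : Vector ℕ (3 + m)) → σ 1 x ≡ σ 1 (prefix m x) + σ 1 (suffix m x)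
σ₁-split zero    x = refl
σ₁-split (suc m) x = trans (cong (head x * 1 +_) (σ₁-split m (tail x))) (sym (+-assoc (head x * 1) _ _))

σ₂-split : ∀ m (x : Vector ℕ (3 + m)) →
  σ 2 x ≡ σ 2 (prefix m x) + σ 1 (prefix m x) * σ 1 (suffix m x) + σ 2 (suffix m x)
σ₂-split zero    x = refl
σ₂-split (suc m) x = begin
  a * σ 1 (tail x) + σ 2 (tail x)
    ≡⟨ cong₂ (λ s q → a * s + q) (σ₁-split m (tail x)) (σ₂-split m (tail x)) ⟩
  a * (S + W₁) + (Q + S * W₁ + W₂)
    ≡⟨ expand a S Q W₁ W₂ ⟩
  (a * S + Q) + (a * 1 + S) * W₁ + W₂
    ∎
  where
  open ≡-Reasoning
  a S Q W₁ W₂ : ℕ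
  a = head x
  S = σ 1 (prefix m (tail x))
  Q = σ 2 (prefix m (tail x))
  W₁ = σ 1 (suffix m (tail x))
  W₂ = σ 2 (suffix m (tail x))
  expand : ∀ a S Q W₁ W₂ → a * (S + W₁) + (Q + S * W₁ + W₂) ≡ (a * S + Q) + (a * 1 + S) * W₁ + W₂
  expand = solve-∀

σ-top-split : ∀ m (x : Vector ℕ (3 + m)) → σ (3 + m) x ≡ σ m (prefix m x) * σ 3 (suffix m x)
σ-top-split zero    x = sym (+-identityʳ (σ 3 x))
σ-top-split (suc m) x = begin
  σ (4 + m) x                                               ≡⟨ σₙ-cons x ⟩
  head x * σ (3 + m) (tail x)                               ≡⟨ cong (head x *_) (σ-top-split m (tail x)) ⟩
  head x * (σ m (prefix m (tail x)) * σ 3 (suffix m (tail x)))  ≡⟨ *-assoc (head x) _ _ ⟨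
  head x * σ m (prefix m (tail x)) * σ 3 (suffix m (tail x))  ≡⟨ cong (_* σ 3 (suffix m (tail x))) (σₙ-cons (prefix (suc m) x)) ⟨
  σ (suc m) (prefix (suc m) x) * σ 3 (suffix (suc m) x)     ∎
  where open ≡-Reasoning

σ₁-triple : ∀ a b c → σ 1 (a ∷ b ∷ c ∷ []) ≡ a + b + c
σ₁-triple = normalise
  where
  normalise : ∀ a b c → a * 1 + (b * 1 + (c * 1 + 0)) ≡ a + b + c
  normalise = solve-∀

σ₂-triple : ∀ a b c → σ 2 (a ∷ b ∷ c ∷ []) ≡ a * b + a * c + b * c
σ₂-triple = normalise
  where
  normalise : ∀ a b c → a * (b * 1 + (c * 1 + 0)) + (b * (c * 1 + 0) + (c * 0 + 0)) ≡ a * b + a * c + b * c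
  normalise = solve-∀

σ₃-triple : ∀ a b c → σ 3 (a ∷ b ∷ c ∷ []) ≡ a * b * c
σ₃-triple = normalise
  where
  normalise : ∀ a b c → a * (b * (c * 1 + 0) + (c * 0 + 0)) + (b * (c * 0 + 0) + (c * 0 + 0)) ≡ a * b * c
  normalise = solve-∀

m≤σ₁ : ∀ {m} (v : Vector ℕ m) → (∀ i → 1 ≤ v i) → m ≤ σ 1 v
m≤σ₁ {zero}  v pos = z≤n
m≤σ₁ {suc m} v pos = subst (suc m ≤_) (sym (σ₁-cons v)) (+-mono-≤ (pos Fin.zero) (m≤σ₁ (tail v) (pos ∘ Fin.suc)))

σ₁≤m*t : ∀ {m} t (v : Vector ℕ m) → (∀ i → v i ≤ t) → σ 1 v ≤ m * t
σ₁≤m*t {zero}  t v v≤t = z≤n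
σ₁≤m*t {suc m} t v v≤t = subst (_≤ suc m * t) (sym (σ₁-cons v)) (+-mono-≤ (v≤t Fin.zero) (σ₁≤m*t t (tail v) (v≤t ∘ Fin.suc)))

1≤σₘ : ∀ {m} (v : Vector ℕ m) → (∀ i → 1 ≤ v i) → 1 ≤ σ m v
1≤σₘ {zero}  v pos = s≤s z≤n
1≤σₘ {suc m} v pos = subst (1 ≤_) (sym (σₙ-cons v)) (*-mono-≤ (pos Fin.zero) (1≤σₘ (tail v) (pos ∘ Fin.suc)))

a+b≤a*b+1 : ∀ {a b} → 1 ≤ a → 1 ≤ b → a + b ≤ a * b + 1
a+b≤a*b+1 {suc a} {suc b} _ _ = subst (suc a + suc b ≤_) (expand a b) (m≤m+n (suc a + suc b) (a * b))
  where
  expand : ∀ a b → suc a + suc b + a * b ≡ suc a * suc b + 1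
  expand = solve-∀

σ₁<σₘ+m : ∀ {m} (v : Vector ℕ m) → (∀ i → 1 ≤ v i) → σ 1 v < σ m v + m
σ₁<σₘ+m {zero}  v pos = s≤s z≤n
σ₁<σₘ+m {suc m} v pos = begin-strict
  σ 1 v                 ≡⟨ σ₁-cons v ⟩
  a + σ 1 (tail v)      <⟨ +-monoʳ-< a (σ₁<σₘ+m (tail v) (pos ∘ Fin.suc)) ⟩
  a + (p + m)           ≡⟨ +-assoc a p m ⟨
  a + p + m             ≤⟨ +-monoˡ-≤ m (a+b≤a*b+1 (pos Fin.zero) (1≤σₘ (tail v) (pos ∘ Fin.suc))) ⟩
  a * p + 1 + m         ≡⟨ +-assoc (a * p) 1 m ⟩
  a * p + suc m         ≡⟨ cong (_+ suc m) (σₙ-cons v) ⟨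
  σ (suc m) v + suc m   ∎
  where
  open ≤-Reasoning
  a p : ℕ
  a = head v
  p = σ m (tail v)

2σ₂+σ₁≤σ₁² : ∀ {m} (v : Vector ℕ m) → (∀ i → 1 ≤ v i) → 2 * σ 2 v + σ 1 v ≤ σ 1 v * σ 1 v
2σ₂+σ₁≤σ₁² {zero}  v pos = z≤n
2σ₂+σ₁≤σ₁² {suc m} v pos = subst (λ s → 2 * σ 2 v + s ≤ s * s) (sym (σ₁-cons v)) (begin
  2 * (a * s + q) + (a + s)        ≡⟨ regroup a s q ⟩
  a + 2 * (a * s) + (2 * q + s)    ≤⟨ +-mono-≤ (+-monoˡ-≤ (2 * (a * s)) (m≤m*m a (pos Fin.zero))) (2σ₂+σ₁≤σ₁² (tail v) (pos ∘ Fin.suc)) ⟩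
  a * a + 2 * (a * s) + s * s      ≡⟨ square a s ⟩
  (a + s) * (a + s)                ∎)
  where
  open ≤-Reasoning
  a s q : ℕ
  a = head v
  s = σ 1 (tail v)
  q = σ 2 (tail v)
  m≤m*m : ∀ a → 1 ≤ a → a ≤ a * a
  m≤m*m a 1≤a = subst (_≤ a * a) (*-identityʳ a) (*-monoʳ-≤ a 1≤a)
  regroup : ∀ a s q → 2 * (a * s + q) + (a + s) ≡ a + 2 * (a * s) + (2 * q + s)
  regroup = solve-∀
  square : ∀ a s → a * a + 2 * (a * s) + s * s ≡ (a + s) * (a + s)
  square = solve-∀

NonDecreasing : ∀ {n} → Vector ℕ n → Set
NonDecreasing x = ∀ i j → i Fin.≤ j → x i ≤ x j

tail-nonDecreasing : ∀ {n} {x : Vector ℕ (suc n)} → NonDecreasing x → NonDecreasing (tail x)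
tail-nonDecreasing mono i j i≤j = mono (Fin.suc i) (Fin.suc j) (s≤s i≤j)

prefix-positive : ∀ m (x : Vector ℕ (3 + m)) → (∀ i → 1 ≤ x i) → ∀ i → 1 ≤ prefix m x i
prefix-positive (suc m) x pos Fin.zero    = pos Fin.zero
prefix-positive (suc m) x pos (Fin.suc i) = prefix-positive m (tail x) (pos ∘ Fin.suc) i

head≤suffix : ∀ m (x : Vector ℕ (3 + m)) → NonDecreasing x → ∀ j → head x ≤ suffix m x j
head≤suffix zero    x mono j = mono Fin.zero j z≤n
head≤suffix (suc m) x mono j =
  ≤-trans (mono Fin.zero (Fin.suc Fin.zero) z≤n) (head≤suffix m (tail x) (tail-nonDecreasing mono) j)

prefix≤suffix : ∀ m (x : Vector ℕ (3 + m)) → NonDecreasing x → ∀ i j → prefix m x i ≤ suffix m x j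
prefix≤suffix (suc m) x mono Fin.zero    j = head≤suffix (suc m) x mono j
prefix≤suffix (suc m) x mono (Fin.suc i) j = prefix≤suffix m (tail x) (tail-nonDecreasing mono) i j

suffix-nonDecreasing : ∀ m (x : Vector ℕ (3 + m)) → NonDecreasing x → NonDecreasing (suffix m x)
suffix-nonDecreasing zero    x mono = mono
suffix-nonDecreasing (suc m) x mono = suffix-nonDecreasing m (tail x) (tail-nonDecreasing mono)

suffix-positive : ∀ m (x : Vector ℕ (3 + m)) → (∀ i → 1 ≤ x i) → ∀ j → 1 ≤ suffix m x j
suffix-positive zero    x pos = pos
suffix-positive (suc m) x pos = suffix-positive m (tail x) (pos ∘ Fin.suc)

suffix-head≡idx : ∀ m (x : Vector ℕ (3 + m)) (h : 3 ≤ 3 + m) → suffix m x Fin.zero ≡ x (idx (3 + m) h)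
suffix-head≡idx zero    x h = refl
suffix-head≡idx (suc m) x h = suffix-head≡idx m (tail x) (m≤m+n 3 m)

-- Multiply by t², bound t², ty and tz by yz, and cancel yz.
small-product-bound : ∀ P S Q t y z → 1 ≤ t → t ≤ y → t ≤ z →
  Q + S * (t + y + z) + (t * y + t * z + y * z) ≡ P * (t * y * z) →
  t * t * t * P ≤ Q + 3 * S * t + 3 * (t * t)
small-product-bound P S Q t y z 1≤t t≤y t≤z σ₂≡σₙ = *-cancelʳ-≤ _ _ (y * z) {{yz≢0}} (begin
  t * t * t * P * (y * z)                                        ≡⟨ shuffle P t y z ⟩
  t * t * (P * (t * y * z))                                      ≡⟨ cong (t * t *_) σ₂≡σₙ ⟨
  t * t * (Q + S * (t + y + z) + (t * y + t * z + y * z))        ≡⟨ regroup S Q t y z ⟩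
  t * t * (Q + S * t) + (S + t) * (t * (t * y + t * z)) + t * t * (y * z)
    ≤⟨ +-monoˡ-≤ (t * t * (y * z)) (+-mono-≤ (*-monoˡ-≤ (Q + S * t) tt≤yz)
         (*-monoʳ-≤ (S + t) (*-monoʳ-≤ t (+-mono-≤ ty≤yz tz≤yz)))) ⟩
  y * z * (Q + S * t) + (S + t) * (t * (y * z + y * z)) + t * t * (y * z) ≡⟨ collect S Q t y z ⟩
  (Q + 3 * S * t + 3 * (t * t)) * (y * z)                        ∎)
  where
  open ≤-Reasoning
  yz≢0 : NonZero (y * z)
  yz≢0 = >-nonZero (*-mono-≤ (≤-trans 1≤t t≤y) (≤-trans 1≤t t≤z))
  tt≤yz : t * t ≤ y * z
  tt≤yz = *-mono-≤ t≤y t≤z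
  ty≤yz : t * y ≤ y * z
  ty≤yz = subst (_≤ y * z) (*-comm y t) (*-monoʳ-≤ y t≤z)
  tz≤yz : t * z ≤ y * z
  tz≤yz = *-monoˡ-≤ z t≤y
  shuffle : ∀ P t y z → t * t * t * P * (y * z) ≡ t * t * (P * (t * y * z))
  shuffle = solve-∀
  regroup : ∀ S Q t y z → t * t * (Q + S * (t + y + z) + (t * y + t * z + y * z))
    ≡ t * t * (Q + S * t) + (S + t) * (t * (t * y + t * z)) + t * t * (y * z)
  regroup = solve-∀
  collect : ∀ S Q t y z → y * z * (Q + S * t) + (S + t) * (t * (y * z + y * z)) + t * t * (y * z)
    ≡ (Q + 3 * S * t + 3 * (t * t)) * (y * z)
  collect = solve-∀

-- Put S = m + d.  The excess d is weighted by 2t³ + 1 on the left and by 2m + d + 6t on the right;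
-- when the latter is larger, t is already small.
cubic-inequality : ∀ m t S P Q → 1 ≤ t → m ≤ S → S ≤ m * t → S < P + m → 2 * Q + S ≤ S * S →
  t * t * t * P ≤ Q + 3 * S * t + 3 * (t * t) →
  2 * (t * t * t) ≤ 6 * (t * t) + 6 * t * m + m * m
cubic-inequality m t S P Q 1≤t m≤S S≤mt S<P+m σ₂-bound product-bound with m≤n⇒∃[o]m+o≡n m≤S
... | d , refl with 2 * m + d + 6 * t ≤? 2 * (t * t * t) + 1
...   | yes small-excess = ≤-trans (m≤m+n (2 * T) m) (+-cancelʳ-≤ (d * (2 * T + 1)) _ _ (begin
          2 * T + m + d * (2 * T + 1)       ≤⟨ excess-bound ⟩
          X + d * (2 * m + d + 6 * t)       ≤⟨ +-monoʳ-≤ X (*-monoʳ-≤ d small-excess) ⟩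
          X + d * (2 * T + 1)               ∎))
  where
  open ≤-Reasoning
  T X : ℕ
  T = t * t * t
  X = 6 * (t * t) + 6 * t * m + m * m
  d<P : d < P
  d<P = +-cancelʳ-< m d P (subst (_< P + m) (+-comm m d) S<P+m)
  excess-bound : 2 * T + m + d * (2 * T + 1) ≤ X + d * (2 * m + d + 6 * t)
  excess-bound = begin
    2 * T + m + d * (2 * T + 1)                         ≡⟨ regroup T m d ⟩
    2 * T * suc d + (m + d)                             ≤⟨ +-monoˡ-≤ (m + d) (*-monoʳ-≤ (2 * T) d<P) ⟩
    2 * T * P + (m + d)                                 ≡⟨ cong (_+ (m + d)) (*-assoc 2 T P) ⟩
    2 * (T * P) + (m + d)                               ≤⟨ +-monoˡ-≤ (m + d) (*-monoʳ-≤ 2 product-bound) ⟩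
    2 * (Q + 3 * (m + d) * t + 3 * (t * t)) + (m + d)   ≡⟨ distribute m d t Q ⟩
    (2 * Q + (m + d)) + 6 * (m + d) * t + 6 * (t * t)   ≤⟨ +-monoˡ-≤ (6 * (t * t)) (+-monoˡ-≤ (6 * (m + d) * t) σ₂-bound) ⟩
    (m + d) * (m + d) + 6 * (m + d) * t + 6 * (t * t)   ≡⟨ expand m d t ⟩
    X + d * (2 * m + d + 6 * t)                         ∎
    where
    regroup : ∀ T m d → 2 * T + m + d * (2 * T + 1) ≡ 2 * T * suc d + (m + d)
    regroup = solve-∀
    distribute : ∀ m d t Q → 2 * (Q + 3 * (m + d) * t + 3 * (t * t)) + (m + d)
      ≡ (2 * Q + (m + d)) + 6 * (m + d) * t + 6 * (t * t)
    distribute = solve-∀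
    expand : ∀ m d t → (m + d) * (m + d) + 6 * (m + d) * t + 6 * (t * t)
      ≡ 6 * (t * t) + 6 * t * m + m * m + d * (2 * m + d + 6 * t)
    expand = solve-∀
...   | no large-excess = ≤-trans (≤-trans (m≤m+n _ 1) (<⇒≤ (≰⇒> large-excess))) (begin
          2 * m + d + 6 * t                 ≡⟨ split m d t ⟩
          m + (m + d) + 6 * t               ≤⟨ +-monoˡ-≤ (6 * t) (+-mono-≤ m≤mt S≤mt) ⟩
          m * t + m * t + 6 * t             ≤⟨ +-mono-≤ (+-mono-≤ (m≤m+n (m * t) (4 * (m * t))) ≤-refl) 6t≤6tt ⟩
          m * t + 4 * (m * t) + m * t + 6 * t * t   ≡⟨ collect m t ⟩
          6 * (t * t) + 6 * t * m           ≤⟨ m≤m+n _ (m * m) ⟩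
          6 * (t * t) + 6 * t * m + m * m   ∎)
  where
  open ≤-Reasoning
  m≤mt : m ≤ m * t
  m≤mt = subst (_≤ m * t) (*-identityʳ m) (*-monoʳ-≤ m 1≤t)
  6t≤6tt : 6 * t ≤ 6 * t * t
  6t≤6tt = subst (_≤ 6 * t * t) (*-identityʳ (6 * t)) (*-monoʳ-≤ (6 * t) 1≤t)
  split : ∀ m d t → 2 * m + d + 6 * t ≡ m + (m + d) + 6 * t
  split = solve-∀
  collect : ∀ m t → m * t + 4 * (m * t) + m * t + 6 * t * t ≡ 6 * (t * t) + 6 * t * m
  collect = solve-∀

2ab≤a²+b²-ordered : ∀ {a b} → a ≤ b → 2 * a * b ≤ a * a + b * b
2ab≤a²+b²-ordered {a} a≤b with m≤n⇒∃[o]m+o≡n a≤b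
... | d , refl = subst (2 * a * (a + d) ≤_) (square a d) (m≤m+n _ (d * d))
  where
  square : ∀ a d → 2 * a * (a + d) + d * d ≡ a * a + (a + d) * (a + d)
  square = solve-∀

2ab≤a²+b² : ∀ a b → 2 * a * b ≤ a * a + b * b
2ab≤a²+b² a b with ≤-total a b
... | inj₁ a≤b = 2ab≤a²+b²-ordered a≤b
... | inj₂ b≤a = subst₂ _≤_ (swap a b) (+-comm (b * b) (a * a)) (2ab≤a²+b²-ordered b≤a)
  where
  swap : ∀ a b → 2 * b * a ≡ 2 * a * b
  swap = solve-∀

cubic-inequality⇒t<6 : ∀ t m → 2 * (t * t * t) ≤ 6 * (t * t) + 6 * t * m + m * m →
  8 * (m * m) < t * t * t → t < 6
cubic-inequality⇒t<6 t m cubic 8m²<t³ =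
  *-cancelˡ-< 12 t 6 (*-cancelʳ-< (t * t) (12 * t) 72 (+-cancelʳ-< (4 * T) _ _ (begin-strict
    12 * t * (t * t) + 4 * T                  ≡⟨ split t ⟩
    8 * (2 * T)                               ≤⟨ *-monoʳ-≤ 8 cubic ⟩
    8 * (6 * (t * t) + 6 * t * m + m * m)     ≡⟨ expand t m ⟩
    48 * (t * t) + 24 * (2 * t * m) + 8 * (m * m)
      ≤⟨ +-monoˡ-≤ (8 * (m * m)) (+-monoʳ-≤ (48 * (t * t)) (*-monoʳ-≤ 24 (2ab≤a²+b² t m))) ⟩
    48 * (t * t) + 24 * (t * t + m * m) + 8 * (m * m) ≡⟨ collect t m ⟩
    72 * (t * t) + 4 * (8 * (m * m))          <⟨ +-monoʳ-< (72 * (t * t)) (*-monoʳ-< 4 8m²<t³) ⟩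
    72 * (t * t) + 4 * T                      ∎)))
  where
  open ≤-Reasoning
  T : ℕ
  T = t * t * t
  split : ∀ t → 12 * t * (t * t) + 4 * (t * t * t) ≡ 8 * (2 * (t * t * t))
  split = solve-∀
  expand : ∀ t m → 8 * (6 * (t * t) + 6 * t * m + m * m) ≡ 48 * (t * t) + 24 * (2 * t * m) + 8 * (m * m)
  expand = solve-∀
  collect : ∀ t m → 48 * (t * t) + 24 * (t * t + m * m) + 8 * (m * m) ≡ 72 * (t * t) + 4 * (8 * (m * m))
  collect = solve-∀

cubic-inequality⇒m≡0∧t≡3 : ∀ t m → 2 * (t * t * t) ≤ 6 * (t * t) + 6 * t * m + m * m →
  8 * (suc m * suc m) < t * t * t → m ≡ 0 × t ≡ 3
cubic-inequality⇒m≡0∧t≡3 t m cubic 8[m+1]²<t³ =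
  subst₂ Claim (toℕ-fromℕ< t<6) (toℕ-fromℕ< m<3) (table (fromℕ< t<6) (fromℕ< m<3)) cubic 8[m+1]²<t³
  where
  Claim : ℕ → ℕ → Set
  Claim t m = 2 * (t * t * t) ≤ 6 * (t * t) + 6 * t * m + m * m →
    8 * (suc m * suc m) < t * t * t → m ≡ 0 × t ≡ 3
  claim? : ∀ t m → Dec (Claim t m)
  claim? t m = (_ ≤? _) →-dec (_ <? _) →-dec (m ≟ 0) ×-dec (t ≟ 3)
  table : ∀ (i : Fin 6) (j : Fin 3) → Claim (toℕ i) (toℕ j)
  table = toWitness {a? = all? λ i → all? λ j → claim? (toℕ i) (toℕ j)} _
  t<6 : t < 6
  t<6 = cubic-inequality⇒t<6 t m cubic (≤-<-trans (*-monoʳ-≤ 8 (*-mono-≤ (n≤1+n m) (n≤1+n m))) 8[m+1]²<t³)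
  m<3 : m < 3
  m<3 = ≰⇒> λ 3≤m → <-irrefl refl (begin-strict
    8 * (suc m * suc m)   <⟨ 8[m+1]²<t³ ⟩
    t * t * t             ≤⟨ *-mono-≤ (*-mono-≤ t≤5 t≤5) t≤5 ⟩
    125                   <⟨ m<m+n 125 z<s ⟩
    8 * (4 * 4)           ≤⟨ *-monoʳ-≤ 8 (*-mono-≤ (s≤s 3≤m) (s≤s 3≤m)) ⟩
    8 * (suc m * suc m)   ∎)
    where
    open ≤-Reasoning
    t≤5 : t ≤ 5
    t≤5 = ≤-pred t<6

cubic-inequality⇒t≤m : ∀ t m → 2 * (t * t * t) ≤ 6 * (t * t) + 6 * t * m + m * m → 6 ≤ m → t ≤ m
cubic-inequality⇒t≤m t m cubic 6≤m = ≮⇒≥ λ m<t → <⇒≱ (<-≤-trans m<t (≤-pred (t<7 m<t))) 6≤m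
  where
  t<7 : m < t → t < 7
  t<7 m<t = *-cancelˡ-< 2 t 7 (s≤s (*-cancelʳ-≤ (2 * t) 13 (t * t) {{tt≢0}} (begin
    2 * t * (t * t)                      ≡⟨ *-assoc 2 t (t * t) ⟩
    2 * (t * (t * t))                    ≡⟨ cong (2 *_) (*-assoc t t t) ⟨
    2 * (t * t * t)                      ≤⟨ cubic ⟩
    6 * (t * t) + 6 * t * m + m * m      ≤⟨ +-mono-≤ (+-monoʳ-≤ (6 * (t * t)) (*-monoʳ-≤ (6 * t) m≤t)) (*-mono-≤ m≤t m≤t) ⟩
    6 * (t * t) + 6 * t * t + t * t      ≡⟨ collect t ⟩
    13 * (t * t)                         ∎)))
    where
    open ≤-Reasoning
    m≤t : m ≤ t
    m≤t = <⇒≤ m<t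
    tt≢0 : NonZero (t * t)
    tt≢0 = >-nonZero (*-mono-≤ (≤-trans z<s m<t) (≤-trans z<s m<t))
    collect : ∀ t → 6 * (t * t) + 6 * t * t + t * t ≡ 13 * (t * t)
    collect = solve-∀

cubic-inequality⇒m<12b³t : ∀ a b t m → b * b * b < 2 * (a * a * a) →
  a * a * a * (suc m * suc m) < b * t * (b * t) * (b * t) →
  2 * (t * t * t) ≤ 6 * (t * t) + 6 * t * m + m * m → t ≤ m → m < 12 * (b * b * b) * t
cubic-inequality⇒m<12b³t a b t m b³<2a³ lower cubic t≤m = *-cancelʳ-< m m (12 * β * t) (begin-strict
  m * m                 ≤⟨ m*m≤M ⟩
  M                     <⟨ +-cancelʳ-< (β * M) M (β * (12 * t * m)) chain ⟩
  β * (12 * t * m)      ≡⟨ reassoc β t m ⟩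
  12 * β * t * m        ∎)
  where
  open ≤-Reasoning
  β M : ℕ
  β = b * b * b
  M = suc m * suc m
  m*m≤M : m * m ≤ M
  m*m≤M = *-mono-≤ (n≤1+n m) (n≤1+n m)
  chain : suc β * M < β * (12 * t * m) + β * M
  chain = begin-strict
    suc β * M                           ≤⟨ *-monoˡ-≤ M b³<2a³ ⟩
    2 * (a * a * a) * M                 ≡⟨ *-assoc 2 (a * a * a) M ⟩
    2 * (a * a * a * M)                 <⟨ *-monoʳ-< 2 lower ⟩
    2 * (b * t * (b * t) * (b * t))     ≡⟨ factor b t ⟩
    β * (2 * (t * t * t))               ≤⟨ *-monoʳ-≤ β cubic ⟩
    β * (6 * (t * t) + 6 * t * m + m * m)
      ≤⟨ *-monoʳ-≤ β (+-mono-≤ (+-monoˡ-≤ (6 * t * m) (*-monoʳ-≤ 6 (*-monoʳ-≤ t t≤m))) m*m≤M) ⟩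
    β * (6 * (t * m) + 6 * t * m + M)   ≡⟨ expand β t m M ⟩
    β * (12 * t * m) + β * M            ∎
    where
    factor : ∀ b t → 2 * (b * t * (b * t) * (b * t)) ≡ b * b * b * (2 * (t * t * t))
    factor = solve-∀
    expand : ∀ β t m M → β * (6 * (t * m) + 6 * t * m + M) ≡ β * (12 * t * m) + β * M
    expand = solve-∀
  reassoc : ∀ β t m → β * (12 * t * m) ≡ 12 * β * t * m
  reassoc = solve-∀

-- For m ≥ 6 one has t ≤ m, then m < 12b³t and 2t³ ≤ 13m², whence 2m < 13(12b³)³.
ceiling-threshold : ℕ → ℕ
ceiling-threshold b = 6 + 13 * (B * B * B)
  where
  B : ℕ
  B = 12 * (b * b * b)

cubic-inequality⇒m-bounded : ∀ a b t m → b * b * b < 2 * (a * a * a) →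
  a * a * a * (suc m * suc m) < b * t * (b * t) * (b * t) →
  2 * (t * t * t) ≤ 6 * (t * t) + 6 * t * m + m * m → m < ceiling-threshold b
cubic-inequality⇒m-bounded a b t m b³<2a³ lower cubic with 6 ≤? m
... | no  m≱6 = ≤-trans (≰⇒> m≱6) (m≤m+n 6 _)
... | yes 6≤m = <-≤-trans (≤-<-trans (m≤m+n m _) (*-cancelʳ-< (m * m) (2 * m) (13 * B³) (begin-strict
      2 * m * (m * m)                   ≡⟨ *-assoc 2 m (m * m) ⟩
      2 * (m * (m * m))                 ≡⟨ cong (2 *_) (*-assoc m m m) ⟨
      2 * (m * m * m)                   <⟨ *-monoʳ-< 2 (*-mono-< (*-mono-< m<Bt m<Bt) m<Bt) ⟩
      2 * (B * t * (B * t) * (B * t))   ≡⟨ factor B t ⟩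
      B³ * (2 * (t * t * t))            ≤⟨ *-monoʳ-≤ B³ t³-bound ⟩
      B³ * (13 * (m * m))               ≡⟨ *-comm B³ _ ⟩
      13 * (m * m) * B³                 ≡⟨ reassoc m B³ ⟩
      13 * B³ * (m * m)                 ∎))) (m≤n+m _ 6)
  where
  open ≤-Reasoning
  B B³ : ℕ
  B = 12 * (b * b * b)
  B³ = B * B * B
  t≤m : t ≤ m
  t≤m = cubic-inequality⇒t≤m t m cubic 6≤m
  m<Bt : m < B * t
  m<Bt = cubic-inequality⇒m<12b³t a b t m b³<2a³ lower cubic t≤m
  t³-bound : 2 * (t * t * t) ≤ 13 * (m * m)
  t³-bound = begin
    2 * (t * t * t)                    ≤⟨ cubic ⟩
    6 * (t * t) + 6 * t * m + m * m    ≤⟨ +-monoˡ-≤ (m * m) (+-mono-≤ (*-monoʳ-≤ 6 (*-mono-≤ t≤m t≤m)) (*-monoˡ-≤ m (*-monoʳ-≤ 6 t≤m))) ⟩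
    6 * (m * m) + 6 * m * m + m * m    ≡⟨ collect m ⟩
    13 * (m * m)                       ∎
    where
    collect : ∀ m → 6 * (m * m) + 6 * m * m + m * m ≡ 13 * (m * m)
    collect = solve-∀
  factor : ∀ B t → 2 * (B * t * (B * t) * (B * t)) ≡ B * B * B * (2 * (t * t * t))
  factor = solve-∀
  reassoc : ∀ m B³ → 13 * (m * m) * B³ ≡ 13 * B³ * (m * m)
  reassoc = solve-∀

admissible⇒cubic-inequality : ∀ m (x : Vector ℕ (3 + m)) → Admissible (3 + m) x →
  let t = suffix m x Fin.zero in 2 * (t * t * t) ≤ 6 * (t * t) + 6 * t * m + m * m
admissible⇒cubic-inequality m x (pos , mono , σ₂≡σₙ) =
  cubic-inequality m t S P Q 1≤t (m≤σ₁ v v-pos) (σ₁≤m*t t v (λ i → prefix≤suffix m x mono i Fin.zero))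
    (σ₁<σₘ+m v v-pos) (2σ₂+σ₁≤σ₁² v v-pos)
    (small-product-bound P S Q t y z 1≤t (w-mono Fin.zero (Fin.suc Fin.zero) z≤n) (w-mono Fin.zero (Fin.suc (Fin.suc Fin.zero)) z≤n) identity)
  where
  v : Vector ℕ m
  v = prefix m x
  w : Vector ℕ 3
  w = suffix m x
  t y z S Q P : ℕ
  t = w Fin.zero
  y = w (Fin.suc Fin.zero)
  z = w (Fin.suc (Fin.suc Fin.zero))
  S = σ 1 v
  Q = σ 2 v
  P = σ m v
  v-pos : ∀ i → 1 ≤ v i
  v-pos = prefix-positive m x pos
  w-mono : NonDecreasing w
  w-mono = suffix-nonDecreasing m x mono
  1≤t : 1 ≤ t
  1≤t = suffix-positive m x pos Fin.zero
  identity : Q + S * (t + y + z) + (t * y + t * z + y * z) ≡ P * (t * y * z)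
  identity = begin
    Q + S * (t + y + z) + (t * y + t * z + y * z) ≡⟨ cong₂ (λ s₁ s₂ → Q + S * s₁ + s₂) (σ₁-triple t y z) (σ₂-triple t y z) ⟨
    Q + S * σ 1 w + σ 2 w                          ≡⟨ σ₂-split m x ⟨
    σ 2 x                                          ≡⟨ σ₂≡σₙ ⟩
    σ (3 + m) x                                    ≡⟨ σ-top-split m x ⟩
    P * σ 3 w                                      ≡⟨ cong (P *_) (σ₃-triple t y z) ⟩
    P * (t * y * z)                                ∎
    where open ≡-Reasoning

m^2≡m*m : ∀ m → m ^ 2 ≡ m * m
m^2≡m*m m = cong (m *_) (*-identityʳ m)

m^3≡m*m*m : ∀ m → m ^ 3 ≡ m * m * m
m^3≡m*m*m m = trans (cong (m *_) (m^2≡m*m m)) (sym (*-assoc m m m))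

^-cancelˡ-< : ∀ k {a b} → a ^ k < b ^ k → a < b
^-cancelˡ-< k aᵏ<bᵏ = ≰⇒> λ b≤a → <⇒≱ aᵏ<bᵏ (^-monoˡ-≤ k b≤a)

-- Only the lower half 8(n-2)² < (f+1)³ of the floor condition is needed.
floor-bound : ∀ m (h : 3 ≤ 3 + m) (x : Vector ℕ (3 + m)) → Admissible (3 + m) x →
  ∀ f → IsFloorTwoPow (3 + m) f → x (idx (3 + m) h) ≤ 1 + f × (x (idx (3 + m) h) ≡ 1 + f → 3 + m ≡ 3)
floor-bound m h x adm f (_ , 8[m+1]²<[f+1]³) rewrite sym (suffix-head≡idx m x h) =
  t≤1+f , λ t≡1+f → cong (3 +_) (proj₁ (exceeds (≤-reflexive (sym t≡1+f))))
  where
  t : ℕ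
  t = suffix m x Fin.zero
  exceeds : f < t → m ≡ 0 × t ≡ 3
  exceeds f<t = cubic-inequality⇒m≡0∧t≡3 t m (admissible⇒cubic-inequality m x adm)
    (subst₂ _<_ (cong (8 *_) (m^2≡m*m (suc m))) (m^3≡m*m*m t) (<-≤-trans 8[m+1]²<[f+1]³ (^-monoˡ-≤ 3 f<t)))
  2≤f : 2 ≤ f
  2≤f = ≤-pred (^-cancelˡ-< 3 (≤-<-trans (*-monoʳ-≤ 8 (m^n>0 (suc m) 2)) 8[m+1]²<[f+1]³))
  t≤1+f : t ≤ 1 + f
  t≤1+f with t ≤? f
  ... | yes t≤f = m≤n⇒m≤1+n t≤f
  ... | no  t≰f = subst (_≤ 1 + f) (sym (proj₂ (exceeds (≰⇒> t≰f)))) (s≤s 2≤f)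

IsCeilRatPow⇒< : ∀ {a b n c t} → 1 ≤ b → IsCeilRatPow a b n c → c < t → a ^ 3 * (n ∸ 2) ^ 2 < (b * t) ^ 3
IsCeilRatPow⇒< 1≤b (ceil-zero ≤0)         0<t = ≤-<-trans ≤0 (^-monoˡ-< 3 (*-mono-≤ 1≤b 0<t))
IsCeilRatPow⇒< 1≤b (ceil-suc c _ ≤[bc+b]³) c<t = ≤-<-trans ≤[bc+b]³ (^-monoˡ-< 3 (*-monoʳ-< _ {{>-nonZero 1≤b}} c<t))

ceiling-bound : ∀ a b → 1 ≤ b → b ^ 3 < 2 * a ^ 3 → ∀ m (h : 3 ≤ 3 + m) →
  Σ (Vector ℕ (3 + m)) (λ x → Admissible (3 + m) x × ∃[ c ] (IsCeilRatPow a b (3 + m) c × c < x (idx (3 + m) h))) →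
  m < ceiling-threshold b
ceiling-bound a b 1≤b b³<2a³ m h (x , adm , c , ceil , c<x) rewrite sym (suffix-head≡idx m x h) =
  cubic-inequality⇒m-bounded a b t m (subst₂ _<_ (m^3≡m*m*m b) (cong (2 *_) (m^3≡m*m*m a)) b³<2a³)
    (subst₂ _<_ (cong₂ _*_ (m^3≡m*m*m a) (m^2≡m*m (suc m))) (m^3≡m*m*m (b * t)) (IsCeilRatPow⇒< 1≤b ceil c<x))
    (admissible⇒cubic-inequality m x adm)
  where
  t : ℕ
  t = suffix m x Fin.zero

corollary2p12 :
    (∀ (n : ℕ) (h : 3 ≤ n) (x : Fin n → ℕ) → Admissible n x →
       ∀ (f : ℕ) → IsFloorTwoPow n f →
         (x (idx n h) ≤ 1 + f) × (x (idx n h) ≡ 1 + f → n ≡ 3))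
    ×
    (∀ (a b : ℕ) → 1 ≤ b → b ^ 3 < 2 * a ^ 3 →
       ∃[ N ] ∀ (n : ℕ) → N ≤ n → (h : 3 ≤ n) →
         ¬ (Σ (Fin n → ℕ) λ x → Admissible n x ×
              (∃[ c ] (IsCeilRatPow a b n c × c < x (idx n h)))))
corollary2p12 =
  (λ { (suc (suc (suc m))) h → floor-bound m h
     ; (suc zero) (s≤s ())
     ; (suc (suc zero)) (s≤s (s≤s ())) }) ,
  λ a b 1≤b b³<2a³ → 3 + ceiling-threshold b ,
    λ { (suc (suc (suc m))) N≤n h counterexample →
          <⇒≱ (ceiling-bound a b 1≤b b³<2a³ m h counterexample) (+-cancelˡ-≤ 3 _ _ N≤n)
      ; (suc zero) _ (s≤s ())
      ; (suc (suc zero)) _ (s≤s (s≤s ())) }
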